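{- Let $q\ge 3$ and let $C_q$ be the palette-gadget. Then there exists a $q$-CNCF-coloring $f\colon V(C_q)\to\{1,\dots,q\}$ of $C_q$ such that (1) $f(c_i)=f(c_i')=i$ for all $i\in\{1,\dots,q\}$, and (2) for every $i\in\{1,\dots,q\}$, the closed neighborhood $N[c_i]$ in $C_q$ contains exactly one vertex of color $i$.
   Context: A map $f\colon V(G)\to\{1,\dots,q\}$ is a $q$-CNCF-coloring of $G$ if for every vertex $v$ the closed neighborhood $N[v]$ contains a vertex whose color differs from the colors of all other vertices of $N[v]$. Graphs $G_k$ ($k\ge1$) are defined recursively: $G_1$ is a single vertex; $G_2$ is $K_{1,3}$ with one edge subdivided by an additional vertex; for $k\ge2$, $G_{k+1}$ is obtained by taking a complete graph $K_{k+1}$, attaching to each vertex $v$ of it two disjoint new copies of $G_k$ with $v$ adjacent to every vertex of both copies, and, for each edge $\{v,w\}$ of $K_{k+1}$, adding two disjoint new copies of $G_{k-1}$ with both $v$ and $w$ adjacent to every vertex of both copies. The palette-gadget $C_q$: start from a complete graph on vertices $c_1,\dots,c_q$; add vertices $c_1',\dots,c_q'$ with $c_i'$ adjacent to $c_j$ for all $j\neq i$; let $D=\{c_i,c_i'\colon i\in[q]\}$; then for every edge $\{u,v\}$ with $u,v\in D$ add two new disjoint copies of $G_{q-1}$ with every vertex of these copies adjacent to both $u$ and $v$. -}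

module Defs where

open import Data.Nat using (ℕ; zero; suc; _∸_)
open import Data.Fin using (Fin; toℕ; _<_)
open import Data.Unit using (⊤)
open import Data.Empty using (⊥)
open import Data.Product using (_×_; ∃)
open import Data.Sum using (_⊎_)
open import Relation.Binary.PropositionalEquality using (_≡_; _≢_)

-- Generic notions for a graph given by a vertex type V and an
-- adjacency relation Adj (assumed symmetric and irreflexive; all the
-- concrete graphs below are).

ClosedNbhd : {V : Set} (Adj : V → V → Set) → V → V → Set
ClosedNbhd Adj v w = w ≡ v ⊎ Adj v w

IsCNCF : {V : Set} (Adj : V → V → Set) (q : ℕ) (f : V → Fin q) → Set
IsCNCF Adj q f =
  ∀ v → ∃ λ u → ClosedNbhd Adj v u ×
    (∀ w → ClosedNbhd Adj v w → w ≢ u → f w ≢ f u)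

-- The graphs G_k.  We index by n = k - 1, i.e. GV n / GAdj n is G_{n+1}.

-- G_2: K_{1,3} with one edge subdivided.  Vertices 0..4:
-- centre 0, leaves 1 and 2, subdivision vertex 3, last leaf 4.
data Star : ℕ → ℕ → Set where
  e01 : Star 0 1
  e02 : Star 0 2
  e03 : Star 0 3
  e34 : Star 3 4

-- Vertex type of the recursive construction on K_m with copies
-- A of G_k attached to vertices and copies B of G_{k-1} attached to edges.
-- An edge {i,j} of K_m is represented by the pair i < j.
data Vtx (m : ℕ) (A B : Set) : Set where
  core  : Fin m → Vtx m A B
  vcopy : Fin m → Fin 2 → A → Vtx m A B
  ecopy : (i j : Fin m) → i < j → Fin 2 → B → Vtx m A B

VAdj : (m : ℕ) {A B : Set} → (A → A → Set) → (B → B → Set) →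
       Vtx m A B → Vtx m A B → Set
VAdj m RA RB (core i) (core j) = i ≢ j
VAdj m RA RB (core i) (vcopy j _ _) = i ≡ j
VAdj m RA RB (vcopy j _ _) (core i) = i ≡ j
VAdj m RA RB (vcopy i c a) (vcopy j d b) = i ≡ j × c ≡ d × RA a b
VAdj m RA RB (core v) (ecopy i j _ _ _) = v ≡ i ⊎ v ≡ j
VAdj m RA RB (ecopy i j _ _ _) (core v) = v ≡ i ⊎ v ≡ j
VAdj m RA RB (ecopy i j _ c a) (ecopy i' j' _ d b) =
  i ≡ i' × j ≡ j' × c ≡ d × RB a b
VAdj m RA RB (vcopy _ _ _) (ecopy _ _ _ _ _) = ⊥
VAdj m RA RB (ecopy _ _ _ _ _) (vcopy _ _ _) = ⊥

GV : ℕ → Set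
GV zero = ⊤
GV (suc zero) = Fin 5
GV (suc (suc n)) = Vtx (suc (suc (suc n))) (GV (suc n)) (GV n)

GAdj : (n : ℕ) → GV n → GV n → Set
GAdj zero _ _ = ⊥
GAdj (suc zero) x y = Star (toℕ x) (toℕ y) ⊎ Star (toℕ y) (toℕ x)
GAdj (suc (suc n)) = VAdj (suc (suc (suc n))) (GAdj (suc n)) (GAdj n)

-- The palette gadget C_q.  Copies of G_{q-1} = GV (q ∸ 2).
-- Edges of D: {c_i, c_j} for i < j, and {c_i', c_j} for i ≢ j.

data CV (q : ℕ) : Set where
  c    : Fin q → CV q
  c'   : Fin q → CV q
  gcc  : (i j : Fin q) → i < j → Fin 2 → GV (q ∸ 2) → CV q   -- on edge {c_i , c_j}
  gc'c : (i j : Fin q) → i ≢ j → Fin 2 → GV (q ∸ 2) → CV q   -- on edge {c_i', c_j}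

CAdj : (q : ℕ) → CV q → CV q → Set
CAdj q (c i) (c j) = i ≢ j
CAdj q (c i) (c' j) = i ≢ j
CAdj q (c' i) (c j) = i ≢ j
CAdj q (c' i) (c' j) = ⊥
CAdj q (c v) (gcc i j _ _ _) = v ≡ i ⊎ v ≡ j
CAdj q (gcc i j _ _ _) (c v) = v ≡ i ⊎ v ≡ j
CAdj q (c v) (gc'c i j _ _ _) = v ≡ j
CAdj q (gc'c i j _ _ _) (c v) = v ≡ j
CAdj q (c' v) (gc'c i j _ _ _) = v ≡ i
CAdj q (gc'c i j _ _ _) (c' v) = v ≡ i
CAdj q (c' v) (gcc _ _ _ _ _) = ⊥
CAdj q (gcc _ _ _ _ _) (c' v) = ⊥
CAdj q (gcc i j _ t x) (gcc i' j' _ t' y) =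
  i ≡ i' × j ≡ j' × t ≡ t' × GAdj (q ∸ 2) x y
CAdj q (gc'c i j _ t x) (gc'c i' j' _ t' y) =
  i ≡ i' × j ≡ j' × t ≡ t' × GAdj (q ∸ 2) x y
CAdj q (gcc _ _ _ _ _) (gc'c _ _ _ _ _) = ⊥
CAdj q (gc'c _ _ _ _ _) (gcc _ _ _ _ _) = ⊥

module Submission where

-- Colour the palette gadget C_q (q ≥ 3) by
--   c_i , c_i'            ↦ i,
--   copies on {c_i , c_j} ↦ a fixed colour distinct from i and j,
--   copies on {c_i', c_j} ↦ i.
-- The colouring ignores the inner structure of the attached copies of
-- G_{q-1}: every vertex of such a copy sees a core vertex c_k whose colour
-- occurs nowhere else in its closed neighbourhood, and c_i' sees c_k for
-- any k ≠ i.  In N[c_i] only c_i itself has colour i, which gives both the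
-- conflict-free property at c_i and part (2) of the theorem.

open import Defs
open import Data.Nat using (ℕ; _≥_; suc; s≤s)
open import Data.Fin using (Fin; zero; suc; _≟_)
open import Data.Product using (_×_; ∃; _,_; proj₁; proj₂)
open import Data.Sum using (inj₁; inj₂)
open import Data.Empty using (⊥-elim)
open import Relation.Nullary using (yes; no)
open import Relation.Binary.PropositionalEquality using (_≡_; _≢_; refl; sym; cong)

UniquelyColouredIn : {V : Set} (Adj : V → V → Set) {q : ℕ} (f : V → Fin q) →
                     V → V → Set
UniquelyColouredIn Adj f v u =
  ClosedNbhd Adj v u × (∀ w → ClosedNbhd Adj v w → f w ≡ f u → w ≡ u)

uniquely-coloured⇒CNCF : {V : Set} (Adj : V → V → Set) {q : ℕ} (f : V → Fin q) →
  (∀ v → ∃ λ u → UniquelyColouredIn Adj f v u) → IsCNCF Adj q f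
uniquely-coloured⇒CNCF Adj f witness v with witness v
... | u , u∈N[v] , unique = u , u∈N[v] , λ w w∈N[v] w≢u fw≡fu → w≢u (unique w w∈N[v] fw≡fu)

avoid-two : {n : ℕ} (a b : Fin (suc (suc (suc n)))) → ∃ λ k → k ≢ a × k ≢ b
avoid-two a b with a ≟ zero | b ≟ zero
... | no a≢0 | no b≢0 = zero , (λ e → a≢0 (sym e)) , (λ e → b≢0 (sym e))
... | yes refl | _ with b ≟ suc zero
...   | no b≢1 = suc zero , (λ ()) , (λ e → b≢1 (sym e))
...   | yes refl = suc (suc zero) , (λ ()) , (λ ())
avoid-two a b | no _ | yes refl with a ≟ suc zero
...   | no a≢1 = suc zero , (λ e → a≢1 (sym e)) , (λ ())
...   | yes refl = suc (suc zero) , (λ ()) , (λ ())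

module PaletteColouring (n : ℕ) where

  q : ℕ
  q = suc (suc (suc n))

  third : Fin q → Fin q → Fin q
  third a b = proj₁ (avoid-two a b)

  third≢ˡ : ∀ a b → third a b ≢ a
  third≢ˡ a b = proj₁ (proj₂ (avoid-two a b))

  third≢ʳ : ∀ a b → third a b ≢ b
  third≢ʳ a b = proj₂ (proj₂ (avoid-two a b))

  colour : CV q → Fin q
  colour (c i)              = i
  colour (c' i)             = i
  colour (gcc i j _ _ _)    = third i j
  colour (gc'c i j _ _ _)   = i

  Unique : CV q → CV q → Set
  Unique = UniquelyColouredIn (CAdj q) colour

  -- c_i is the only vertex of colour i in N[c_i]: its neighbours are other
  -- c_j, c_j' (j ≠ i), copies on {c_i,c_j} (coloured ≠ i) and copies on
  -- {c_j',c_i} (coloured j ≠ i).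
  unique-at-c : ∀ i → Unique (c i) (c i)
  unique-at-c i = inj₁ refl , only-c
    where
    only-c : ∀ w → ClosedNbhd (CAdj q) (c i) w → colour w ≡ i → w ≡ c i
    only-c _ (inj₁ w≡ci) _ = w≡ci
    only-c (c j) (inj₂ i≢j) e = ⊥-elim (i≢j (sym e))
    only-c (c' j) (inj₂ i≢j) e = ⊥-elim (i≢j (sym e))
    only-c (gcc a b _ _ _) (inj₂ (inj₁ refl)) e = ⊥-elim (third≢ˡ a b e)
    only-c (gcc a b _ _ _) (inj₂ (inj₂ refl)) e = ⊥-elim (third≢ʳ a b e)
    only-c (gc'c a b a≢b _ _) (inj₂ refl) e = ⊥-elim (a≢b e)

  -- N[c_i'] consists of c_i', the c_j (j ≠ i) and copies coloured i, so
  -- any c_k with k ≠ i is uniquely coloured there.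
  unique-at-c' : ∀ i → ∃ λ u → Unique (c' i) u
  unique-at-c' i = c k , inj₂ (λ e → k≢i (sym e)) , only-ck
    where
    k : Fin q
    k = third i i
    k≢i : k ≢ i
    k≢i = third≢ˡ i i
    only-ck : ∀ w → ClosedNbhd (CAdj q) (c' i) w → colour w ≡ k → w ≡ c k
    only-ck _ (inj₁ refl) e = ⊥-elim (k≢i (sym e))
    only-ck (c j) (inj₂ _) e = cong c e
    only-ck (gc'c _ _ _ _ _) (inj₂ refl) e = ⊥-elim (k≢i (sym e))

  -- A copy on {c_i, c_j} and its whole copy carry colour third i j ≠ i, so
  -- c_i is the only core neighbour of colour i.
  unique-at-gcc : ∀ i j i<j t x → Unique (gcc i j i<j t x) (c i)
  unique-at-gcc i j i<j t x = inj₂ (inj₁ refl) , only-ci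
    where
    only-ci : ∀ w → ClosedNbhd (CAdj q) (gcc i j i<j t x) w → colour w ≡ i → w ≡ c i
    only-ci _ (inj₁ refl) e = ⊥-elim (third≢ˡ i j e)
    only-ci (c _) (inj₂ _) e = cong c e
    only-ci (gcc _ _ _ _ _) (inj₂ (refl , refl , _)) e = ⊥-elim (third≢ˡ i j e)

  -- A copy on {c_i', c_j} and its whole copy carry colour i ≠ j, as does
  -- c_i', so c_j is the only vertex of colour j around it.
  unique-at-gc'c : ∀ i j i≢j t x → Unique (gc'c i j i≢j t x) (c j)
  unique-at-gc'c i j i≢j t x = inj₂ refl , only-cj
    where
    only-cj : ∀ w → ClosedNbhd (CAdj q) (gc'c i j i≢j t x) w → colour w ≡ j → w ≡ c j
    only-cj _ (inj₁ refl) e = ⊥-elim (i≢j e)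
    only-cj (c _) (inj₂ refl) _ = refl
    only-cj (c' _) (inj₂ refl) e = ⊥-elim (i≢j e)
    only-cj (gc'c _ _ _ _ _) (inj₂ (refl , refl , _)) e = ⊥-elim (i≢j e)

  every-nbhd-has-unique : ∀ v → ∃ λ u → Unique v u
  every-nbhd-has-unique (c i)              = c i , unique-at-c i
  every-nbhd-has-unique (c' i)             = unique-at-c' i
  every-nbhd-has-unique (gcc i j i<j t x)  = c i , unique-at-gcc i j i<j t x
  every-nbhd-has-unique (gc'c i j i≢j t x) = c j , unique-at-gc'c i j i≢j t x

lemma12 : (q : ℕ) → q ≥ 3 →
    ∃ λ (f : CV q → Fin q) →
    IsCNCF (CAdj q) q f ×
    (∀ i → f (c i) ≡ i × f (c' i) ≡ i) ×
    (∀ i → ∃ λ u → ClosedNbhd (CAdj q) (c i) u × f u ≡ i ×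
    (∀ w → ClosedNbhd (CAdj q) (c i) w → f w ≡ i → w ≡ u))
lemma12 (suc (suc (suc n))) (s≤s (s≤s (s≤s _))) =
  colour ,
  uniquely-coloured⇒CNCF (CAdj _) colour every-nbhd-has-unique ,
  (λ i → refl , refl) ,
  λ i → c i , unique-at-c i .proj₁ , refl , unique-at-c i .proj₂
  where open PaletteColouring n
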